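{- Let $\delta$ be a new atomic formula symbol (the fixed point operator of $A(p)=\neg(\exists x)x:p$). Then the logic $\mathsf{QLP}(\delta\leftrightarrow\neg(\exists x)x:\delta)_{\emptyset}$, i.e. $\mathsf{QLP}$ without the Axiom Necessitation rule, over the language extended by $\delta$, with the single additional axiom $\delta\leftrightarrow\neg(\exists x)x:\delta$, is inconsistent.
   Context: Fix countably many justification variables, propositional variables, and primitive function symbols of each arity $n\ge0$; a primitive term is $f(x_1,\dots,x_n)$ with $x_i$ variables. Terms of $\mathsf{QLP}$: $t::= x\mid f(x_1,\dots,x_n)\mid t\cdot t\mid t+t\mid !t\mid(t\forall x)$ ($x$ bound in $(t\forall x)$). Formulas: $A::= p\mid\bot\mid\neg A\mid A\wedge A\mid A\vee A\mid A\rightarrow A\mid t:A\mid(\forall x)A\mid(\exists x)A$, quantifiers over justification variables. Axioms: all propositional tautologies; Q1: $(\forall x)A(x)\rightarrow A(t)$, $t$ free for $x$; Q2: $(\forall x)(A\rightarrow B(x))\rightarrow(A\rightarrow(\forall x)B(x))$, $x$ not free in $A$; Q3: $A(t)\rightarrow(\exists x)A(x)$, $t$ free for $x$; Q4: $(\forall x)(A(x)\rightarrow B)\rightarrow((\exists x)A(x)\rightarrow B)$, $x$ not free in $B$; jK: $s:(A\rightarrow B)\rightarrow(t:A\rightarrow(s\cdot t):B)$; jT: $t:A\rightarrow A$; j4: $t:A\rightarrow !t:t:A$; Sum: $s:A\rightarrow(s+t):A$, $s:A\rightarrow(t+s):A$; UF: $(\exists y)y:(\forall x)t:A\rightarrow(t\forall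 x):(\forall x)A$, $y$ not free in $t$ or $A$. Rules: Modus Ponens; Gen: from $A$ infer $(\forall x)A$; qNec: from $A$ infer $(\exists x)x:A$, $x$ not free in $A$; Axiom Necessitation: from an axiom instance $A$ infer $f(x_1,\dots,x_n):A$. The subscript $\emptyset$ means Axiom Necessitation is dropped. All schemes and rules apply to formulas of the extended language. -}

module Defs where

open import Data.Nat using (ℕ; _≟_)
open import Data.Bool using (Bool; true; false; not; _∧_; _∨_)
open import Data.Maybe using (Maybe; just; nothing)
open import Data.Vec using (Vec; []; _∷_)
open import Data.Vec.Membership.Propositional using (_∈_)
open import Data.Product using (_×_)
open import Data.Sum using (_⊎_)
open import Relation.Nullary using (¬_; yes; no)
open import Relation.Binary.PropositionalEquality using (_≡_; _≢_)

Var : Set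
Var = ℕ

-- Terms of QLP.  fn n f xs  is the primitive term f(x₁,…,xₙ) (f the f-th
-- function symbol of arity n, xᵢ variables).  (t ∀ₜ x) binds x.
data Term : Set where
  var  : Var → Term
  fn   : (n : ℕ) → ℕ → Vec Var n → Term
  _·_  : Term → Term → Term
  _⊕_  : Term → Term → Term
  !_   : Term → Term
  _∀ₜ_ : Term → Var → Term

data Form : Set where
  atom : ℕ → Form
  δ    : Form
  ⊥'   : Form
  ~_   : Form → Form
  _∧'_ : Form → Form → Form
  _∨'_ : Form → Form → Form
  _⇒_  : Form → Form → Form
  _∶_  : Term → Form → Form
  ∀'   : Var → Form → Form
  ∃'   : Var → Form → Form

infixr 5 _⇒_
infix 7 _∶_

_⇔_ : Form → Form → Form
A ⇔ B = (A ⇒ B) ∧' (B ⇒ A)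

FreeT : Var → Term → Set
FreeT x (var y)    = x ≡ y
FreeT x (fn n f xs) = x ∈ xs
FreeT x (s · t)    = FreeT x s ⊎ FreeT x t
FreeT x (s ⊕ t)    = FreeT x s ⊎ FreeT x t
FreeT x (! t)      = FreeT x t
FreeT x (t ∀ₜ y)   = x ≢ y × FreeT x t

FreeF : Var → Form → Set
FreeF x (atom p)  = Data.Empty.⊥ where import Data.Empty
FreeF x δ         = Data.Empty.⊥ where import Data.Empty
FreeF x ⊥'        = Data.Empty.⊥ where import Data.Empty
FreeF x (~ A)     = FreeF x A
FreeF x (A ∧' B)  = FreeF x A ⊎ FreeF x B
FreeF x (A ∨' B)  = FreeF x A ⊎ FreeF x B
FreeF x (A ⇒ B)   = FreeF x A ⊎ FreeF x B
FreeF x (t ∶ A)   = FreeT x t ⊎ FreeF x A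
FreeF x (∀' y A)  = x ≢ y × FreeF x A
FreeF x (∃' y A)  = x ≢ y × FreeF x A

FreeForT : Term → Var → Term → Set
FreeForT t x (var y)    = Data.Unit.⊤ where import Data.Unit
FreeForT t x (fn n f xs) = Data.Unit.⊤ where import Data.Unit
FreeForT t x (r · s)    = FreeForT t x r × FreeForT t x s
FreeForT t x (r ⊕ s)    = FreeForT t x r × FreeForT t x s
FreeForT t x (! s)      = FreeForT t x s
FreeForT t x (s ∀ₜ y)   = (¬ FreeT x (s ∀ₜ y)) ⊎ ((¬ FreeT y t) × FreeForT t x s)

FreeFor : Term → Var → Form → Set
FreeFor t x (atom p)  = Data.Unit.⊤ where import Data.Unit
FreeFor t x δ         = Data.Unit.⊤ where import Data.Unit
FreeFor t x ⊥'        = Data.Unit.⊤ where import Data.Unit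
FreeFor t x (~ A)     = FreeFor t x A
FreeFor t x (A ∧' B)  = FreeFor t x A × FreeFor t x B
FreeFor t x (A ∨' B)  = FreeFor t x A × FreeFor t x B
FreeFor t x (A ⇒ B)   = FreeFor t x A × FreeFor t x B
FreeFor t x (s ∶ A)   = FreeForT t x s × FreeFor t x A
FreeFor t x (∀' y A)  = (¬ FreeF x (∀' y A)) ⊎ ((¬ FreeT y t) × FreeFor t x A)
FreeFor t x (∃' y A)  = (¬ FreeF x (∃' y A)) ⊎ ((¬ FreeT y t) × FreeFor t x A)

-- Since primitive
-- terms only take variables as arguments, the result is undefined (nothing)
-- when x occurs as an argument of a primitive term and t is not a variable.
substVars : ∀ {n} → Var → Term → Vec Var n → Maybe (Vec Var n)
substVars x t []       = just []
substVars x t (y ∷ ys) with substVars x t ys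
... | nothing  = nothing
... | just ys' with x ≟ y
...   | no _  = just (y ∷ ys')
...   | yes _ with t
...     | var z = just (z ∷ ys')
...     | _     = nothing

map2 : ∀ {A B C : Set} → (A → B → C) → Maybe A → Maybe B → Maybe C
map2 f (just a) (just b) = just (f a b)
map2 f _ _ = nothing

map1 : ∀ {A B : Set} → (A → B) → Maybe A → Maybe B
map1 f (just a) = just (f a)
map1 f nothing  = nothing

substT : Term → Var → Term → Maybe Term
substT (var y) x t with x ≟ y
... | yes _ = just t
... | no _  = just (var y)
substT (fn n f xs) x t = map1 (fn n f) (substVars x t xs)
substT (r · s) x t = map2 _·_ (substT r x t) (substT s x t)
substT (r ⊕ s) x t = map2 _⊕_ (substT r x t) (substT s x t)
substT (! s)   x t = map1 !_ (substT s x t)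
substT (s ∀ₜ y) x t with x ≟ y
... | yes _ = just (s ∀ₜ y)
... | no _  = map1 (_∀ₜ y) (substT s x t)

substF : Form → Var → Term → Maybe Form
substF (atom p) x t = just (atom p)
substF δ x t        = just δ
substF ⊥' x t       = just ⊥'
substF (~ A) x t    = map1 ~_ (substF A x t)
substF (A ∧' B) x t = map2 _∧'_ (substF A x t) (substF B x t)
substF (A ∨' B) x t = map2 _∨'_ (substF A x t) (substF B x t)
substF (A ⇒ B) x t  = map2 _⇒_ (substF A x t) (substF B x t)
substF (s ∶ A) x t  = map2 _∶_ (substT s x t) (substF A x t)
substF (∀' y A) x t with x ≟ y
... | yes _ = just (∀' y A)
... | no _  = map1 (∀' y) (substF A x t)
substF (∃' y A) x t with x ≟ y
... | yes _ = just (∃' y A)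
... | no _  = map1 (∃' y) (substF A x t)

-- Propositional tautologies: true under every Boolean valuation of the
-- propositionally-atomic subformulas (atoms, δ, t:A, (∀x)A, (∃x)A).
eval : (Form → Bool) → Form → Bool
eval v ⊥'       = false
eval v (~ A)    = not (eval v A)
eval v (A ∧' B) = eval v A ∧ eval v B
eval v (A ∨' B) = eval v A ∨ eval v B
eval v (A ⇒ B)  = not (eval v A) ∨ eval v B
eval v A        = v A

Tautology : Form → Set
Tautology A = ∀ (v : Form → Bool) → eval v A ≡ true

δAxiom : Form
δAxiom = δ ⇔ (~ ∃' 0 (var 0 ∶ δ))

data ⊢_ : Form → Set where
  taut : ∀ {A} → Tautology A → ⊢ A
  Q1   : ∀ A x t B → substF A x t ≡ just B → FreeFor t x A → ⊢ (∀' x A ⇒ B)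
  Q2   : ∀ A B x → ¬ FreeF x A → ⊢ (∀' x (A ⇒ B) ⇒ (A ⇒ ∀' x B))
  Q3   : ∀ A x t B → substF A x t ≡ just B → FreeFor t x A → ⊢ (B ⇒ ∃' x A)
  Q4   : ∀ A B x → ¬ FreeF x B → ⊢ (∀' x (A ⇒ B) ⇒ (∃' x A ⇒ B))
  jK   : ∀ s t A B → ⊢ (s ∶ (A ⇒ B) ⇒ (t ∶ A ⇒ (s · t) ∶ B))
  jT   : ∀ t A → ⊢ (t ∶ A ⇒ A)
  j4   : ∀ t A → ⊢ (t ∶ A ⇒ (! t) ∶ (t ∶ A))
  sumL : ∀ s t A → ⊢ (s ∶ A ⇒ (s ⊕ t) ∶ A)
  sumR : ∀ s t A → ⊢ (s ∶ A ⇒ (t ⊕ s) ∶ A)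
  UF   : ∀ y x t A → ¬ FreeT y t → ¬ FreeF y A →
         ⊢ (∃' y (var y ∶ ∀' x (t ∶ A)) ⇒ (t ∀ₜ x) ∶ ∀' x A)
  fix  : ⊢ δAxiom
  MP   : ∀ {A B} → ⊢ (A ⇒ B) → ⊢ A → ⊢ B
  Gen  : ∀ {A} x → ⊢ A → ⊢ ∀' x A
  qNec : ∀ {A} x → ¬ FreeF x A → ⊢ A → ⊢ ∃' x (var x ∶ A)

-- The argument is a diagonal one and works for any
-- formula D and variable x not free in D with  ⊢ D ↔ ¬(∃x) x:D :
--   * x:D → D (factivity, jT) and D → ¬(∃x)x:D (the fixed point) give
--     x:D → ¬(∃x)x:D, while x:D → (∃x)x:D by ∃-introduction; hence ¬ x:D.
--   * Generalising over x and eliminating ∃ (Q4) yields ¬(∃x)x:D, so D holds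
--     by the fixed point, and qNec turns the proof of D into (∃x)x:D.
module Submission where

open import Defs
open import Data.Bool using (true; false)
open import Data.Maybe using (just)
open import Data.Nat using (_≟_)
open import Data.Product using (_,_)
open import Data.Sum using (inj₁; inj₂)
open import Data.Unit using (tt)
open import Data.Vec using (Vec; []; _∷_)
open import Relation.Nullary using (¬_; yes; no)
open import Relation.Binary.PropositionalEquality using (_≡_; refl; sym)

private
  variable
    A B C : Form

⇒-trans : ⊢ (A ⇒ B) → ⊢ (B ⇒ C) → ⊢ (A ⇒ C)
⇒-trans {A} {B} {C} ab bc = MP (MP (taut syllogism) ab) bc
  where
  syllogism : Tautology ((A ⇒ B) ⇒ (B ⇒ C) ⇒ (A ⇒ C))
  syllogism v with eval v A | eval v B | eval v C
  ... | true  | true  | true  = refl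
  ... | true  | true  | false = refl
  ... | true  | false | true  = refl
  ... | true  | false | false = refl
  ... | false | true  | true  = refl
  ... | false | true  | false = refl
  ... | false | false | true  = refl
  ... | false | false | false = refl

⇔-to : ⊢ (A ⇔ B) → ⊢ (A ⇒ B)
⇔-to {A} {B} ab = MP (taut projection) ab
  where
  projection : Tautology ((A ⇔ B) ⇒ (A ⇒ B))
  projection v with eval v A | eval v B
  ... | true  | true  = refl
  ... | true  | false = refl
  ... | false | true  = refl
  ... | false | false = refl

⇔-from : ⊢ (A ⇔ B) → ⊢ (B ⇒ A)
⇔-from {A} {B} ab = MP (taut projection) ab
  where
  projection : Tautology ((A ⇔ B) ⇒ (B ⇒ A))
  projection v with eval v A | eval v B
  ... | true  | true  = refl
  ... | true  | false = refl
  ... | false | true  = refl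
  ... | false | false = refl

refute : ⊢ (A ⇒ B) → ⊢ (A ⇒ ~ B) → ⊢ (A ⇒ ⊥')
refute {A} {B} ab anb = MP (MP (taut contradiction) ab) anb
  where
  contradiction : Tautology ((A ⇒ B) ⇒ (A ⇒ ~ B) ⇒ (A ⇒ ⊥'))
  contradiction v with eval v A | eval v B
  ... | true  | true  = refl
  ... | true  | false = refl
  ... | false | true  = refl
  ... | false | false = refl

~-intro : ⊢ (A ⇒ ⊥') → ⊢ (~ A)
~-intro {A} a⊥ = MP (taut negation) a⊥
  where
  negation : Tautology ((A ⇒ ⊥') ⇒ ~ A)
  negation v with eval v A
  ... | true  = refl
  ... | false = refl

~-elim : ⊢ (~ A) → ⊢ A → ⊢ ⊥'
~-elim {A} na a = MP (MP (taut explosion) na) a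
  where
  explosion : Tautology (~ A ⇒ A ⇒ ⊥')
  explosion v with eval v A
  ... | true  = refl
  ... | false = refl

-- Substituting the variable x for x itself is defined and changes nothing;
-- this makes "A itself" an instance A(x) of the Q3 scheme.

substVars-self : ∀ {n} x (ys : Vec Var n) → substVars x (var x) ys ≡ just ys
substVars-self x []       = refl
substVars-self x (y ∷ ys) rewrite substVars-self x ys with x ≟ y
... | yes refl = refl
... | no _     = refl

substT-self : ∀ x s → substT s x (var x) ≡ just s
substT-self x (var y) with x ≟ y
... | yes refl = refl
... | no _     = refl
substT-self x (fn n f ys) rewrite substVars-self x ys = refl
substT-self x (r · s) rewrite substT-self x r | substT-self x s = refl
substT-self x (r ⊕ s) rewrite substT-self x r | substT-self x s = refl
substT-self x (! s) rewrite substT-self x s = refl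
substT-self x (s ∀ₜ y) with x ≟ y
... | yes _ = refl
... | no _ rewrite substT-self x s = refl

substF-self : ∀ x A → substF A x (var x) ≡ just A
substF-self x (atom p) = refl
substF-self x δ        = refl
substF-self x ⊥'       = refl
substF-self x (~ A) rewrite substF-self x A = refl
substF-self x (A ∧' B) rewrite substF-self x A | substF-self x B = refl
substF-self x (A ∨' B) rewrite substF-self x A | substF-self x B = refl
substF-self x (A ⇒ B) rewrite substF-self x A | substF-self x B = refl
substF-self x (s ∶ A) rewrite substT-self x s | substF-self x A = refl
substF-self x (∀' y A) with x ≟ y
... | yes _ = refl
... | no _ rewrite substF-self x A = refl
substF-self x (∃' y A) with x ≟ y
... | yes _ = refl
... | no _ rewrite substF-self x A = refl

-- The variable x is always free for x: a binder either rebinds x (so x has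
-- no free occurrence below it) or binds some y ≠ x (so y is not free in x).

freeForT-self : ∀ x s → FreeForT (var x) x s
freeForT-self x (var y)     = tt
freeForT-self x (fn n f ys) = tt
freeForT-self x (r · s)     = freeForT-self x r , freeForT-self x s
freeForT-self x (r ⊕ s)     = freeForT-self x r , freeForT-self x s
freeForT-self x (! s)       = freeForT-self x s
freeForT-self x (s ∀ₜ y) with x ≟ y
... | yes refl = inj₁ λ { (x≢x , _) → x≢x refl }
... | no x≢y   = inj₂ ((λ y≡x → x≢y (sym y≡x)) , freeForT-self x s)

freeFor-self : ∀ x A → FreeFor (var x) x A
freeFor-self x (atom p) = tt
freeFor-self x δ        = tt
freeFor-self x ⊥'       = tt
freeFor-self x (~ A)    = freeFor-self x A
freeFor-self x (A ∧' B) = freeFor-self x A , freeFor-self x B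
freeFor-self x (A ∨' B) = freeFor-self x A , freeFor-self x B
freeFor-self x (A ⇒ B)  = freeFor-self x A , freeFor-self x B
freeFor-self x (s ∶ A)  = freeForT-self x s , freeFor-self x A
freeFor-self x (∀' y A) with x ≟ y
... | yes refl = inj₁ λ { (x≢x , _) → x≢x refl }
... | no x≢y   = inj₂ ((λ y≡x → x≢y (sym y≡x)) , freeFor-self x A)
freeFor-self x (∃' y A) with x ≟ y
... | yes refl = inj₁ λ { (x≢x , _) → x≢x refl }
... | no x≢y   = inj₂ ((λ y≡x → x≢y (sym y≡x)) , freeFor-self x A)

∃-intro : ∀ x A → ⊢ (A ⇒ ∃' x A)
∃-intro x A = Q3 A x (var x) A (substF-self x A) (freeFor-self x A)

∃-elim : ∀ x → ¬ FreeF x B → ⊢ (A ⇒ B) → ⊢ (∃' x A ⇒ B)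
∃-elim {B} {A} x x∉B ab = MP (Q4 A B x x∉B) (Gen x ab)

fixedPoint-inconsistent : ∀ D x → ¬ FreeF x D →
                          ⊢ (D ⇔ (~ ∃' x (var x ∶ D))) → ⊢ ⊥'
fixedPoint-inconsistent D x x∉D fixedPoint =
  ~-elim unjustifiable (qNec x x∉D provable)
  where
  justified : Form
  justified = ∃' x (var x ∶ D)

  -- x:D gives D by factivity, hence ¬(∃x)x:D, yet also (∃x)x:D.
  noJustification : ⊢ (var x ∶ D ⇒ ⊥')
  noJustification = refute (∃-intro x (var x ∶ D))
                           (⇒-trans (jT (var x) D) (⇔-to fixedPoint))

  unjustifiable : ⊢ (~ justified)
  unjustifiable = ~-intro (∃-elim x (λ ()) noJustification)

  provable : ⊢ D
  provable = MP (⇔-from fixedPoint) unjustifiable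

theorem23 : ⊢ ⊥'
theorem23 = fixedPoint-inconsistent δ 0 (λ ()) fix
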